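{- Let $(\mathcal V,\mathcal T_1)$ and $(\mathcal W,\mathcal T_2)$ be natural spaces derived from pre-natural spaces $(V,\#_1,\preccurlyeq_1)$ and $(W,\#_2,\preccurlyeq_2)$, and let $f$ be a refinement morphism from the first to the second. Then the induced map $f:\mathcal V\to\mathcal W$, $p\mapsto (f(p_n))_n$, is continuous with respect to the apartness topologies.
   Context: Setting: Bishop-style constructive mathematics. A pre-natural space is a triple $(V,\#,\preccurlyeq)$ with $V$ countable and $\#$, $\preccurlyeq$ decidable relations on $V$ such that $\#$ is symmetric and irreflexive, $\preccurlyeq$ is a partial order, and $a\preccurlyeq b$, $c\#b$ imply $c\#a$; $a\prec b$ means $a\preccurlyeq b$, $a\neq b$. A point is a sequence $(p_n)$ in $V$ with $p_{n+1}\preccurlyeq p_n$, such that for each $n$ some $m$ has $p_m\prec p_n$, and such that whenever $a\#b$ some $m$ has $p_m\#a$ or $p_m\#b$; $\mathcal V$ is the set of points; $p\#q$ iff $p_n\#q_n$ for some $n$. For $a\in V$, $\hat a=\{p:\exists m\,(p_m\prec a)\}$. $U\subseteq\mathcal V$ is open (apartness topology) iff for all $x\in U$, $y\in\mathcal V$ one can determine $y\#x$ or $\widehat{y_m}\subseteq U$ for some $m$. It is a natural space if there is a maximal dot $\top\in V$ and every $\hat a$ is inhabited. A refinement morphism is a map $f:V\to W$ such that $f(a)\#_2 f(b)$ implies $a\#_1 b$, $a\preccurlyeq_1 b$ implies $f(a)\preccurlyeq_2 f(b)$, and for every point $p\in\mathcal V$ the sequence $(f(p_n))_n$ is a point of $\mathcal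 W$. -}

module Defs where

open import Level using (Level; _⊔_; Setω) renaming (zero to 0ℓ; suc to lsuc)
open import Data.Nat using (ℕ; suc)
open import Data.Product using (Σ; ∃; _×_; _,_; proj₁; proj₂)
open import Data.Sum using (_⊎_)
open import Relation.Nullary using (¬_; Dec)
open import Relation.Binary.PropositionalEquality using (_≡_)
open import Relation.Binary.Definitions using (DecidableEquality; Decidable; Symmetric)
open import Relation.Binary.Structures using (IsPartialOrder)
open import Relation.Unary using (Pred; _⊆_; _∈_)

record PreNatural : Set₁ where
  field
    V        : Set
    _≟_      : DecidableEquality V
    enum     : ℕ → V
    enum-surj : ∀ a → ∃ λ n → enum n ≡ a
    _#_      : V → V → Set
    _≼_      : V → V → Set
    #-dec    : Decidable _#_
    ≼-dec    : Decidable _≼_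
    #-sym    : Symmetric _#_
    #-irrefl : ∀ a → ¬ (a # a)
    ≼-po     : IsPartialOrder _≡_ _≼_
    ≼-#      : ∀ {a b c} → a ≼ b → c # b → c # a

  _≺_ : V → V → Set
  a ≺ b = (a ≼ b) × ¬ (a ≡ b)

  record IsPoint (p : ℕ → V) : Set where
    field
      decr   : ∀ n → p (suc n) ≼ p n
      shrink : ∀ n → ∃ λ m → p m ≺ p n
      split  : ∀ a b → a # b → ∃ λ m → (p m # a) ⊎ (p m # b)

  Point : Set
  Point = Σ (ℕ → V) IsPoint

  _#ₚ_ : Point → Point → Set
  p #ₚ q = ∃ λ n → proj₁ p n # proj₁ q n

  hat : V → Pred Point 0ℓ
  hat a p = ∃ λ m → proj₁ p m ≺ a

  IsOpen : ∀ {ℓ} → Pred Point ℓ → Set ℓ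
  IsOpen U = ∀ x → x ∈ U → ∀ (y : Point) →
             (y #ₚ x) ⊎ (∃ λ m → hat (proj₁ y m) ⊆ U)


record IsNatural (S : PreNatural) : Set where
  open PreNatural S
  field
    top     : V
    top-max : ∀ a → a ≼ top
    hat-inh : ∀ a → ∃ λ (p : Point) → p ∈ hat a

record RefinementMorphism (S T : PreNatural) : Set where
  private
    module S = PreNatural S
    module T = PreNatural T
  field
    fun      : S.V → T.V
    refl-#   : ∀ {a b} → fun a T.# fun b → a S.# b
    mono     : ∀ {a b} → a S.≼ b → fun a T.≼ fun b
    pres-pt  : ∀ (p : S.Point) → T.IsPoint (λ n → fun (proj₁ p n))

  induced : S.Point → T.Point
  induced p = (λ n → fun (proj₁ p n)) , pres-pt p

ContinuousOpen : ∀ {S T : PreNatural} → (PreNatural.Point S → PreNatural.Point T) → Setω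
ContinuousOpen {S} {T} g =
  ∀ {ℓ} (U : Pred (PreNatural.Point T) ℓ) →
  PreNatural.IsOpen T U → PreNatural.IsOpen S (λ p → g p ∈ U)

module Submission where

open import Defs
open import Data.Product using (_,_; proj₁)
open import Data.Sum using (inj₁; inj₂)
open import Relation.Binary.PropositionalEquality using (_≡_; sym)
open import Relation.Binary.Structures using (IsPartialOrder)
import Relation.Binary.Construct.NonStrictToStrict as NonStrictToStrict

-- For U open and f x ∈ U, openness at f x yields either f y # f x, which
-- reflects to y # x, or a basic neighbourhood (f yₘ)^ ⊆ U.  In the latter case
-- ŷₘ is mapped into (f yₘ)^: if pₖ ≺ yₘ then f pₖ ≼ f yₘ by monotonicity, and
-- since f p is again a point some later term lies strictly below f pₖ.

module _ (S : PreNatural) where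
  open PreNatural S
  open IsPartialOrder ≼-po using (trans; antisym; ≤-respʳ-≈)

  ≺-≼-trans : ∀ {a b c} → a ≺ b → b ≼ c → a ≺ c
  ≺-≼-trans = NonStrictToStrict.<-≤-trans _≡_ _≼_ sym trans antisym ≤-respʳ-≈

  ≼⇒hat : ∀ (p : Point) {a} k → proj₁ p k ≼ a → hat a p
  ≼⇒hat (p , p-pt) k pₖ≼a with IsPoint.shrink p-pt k
  ... | m , pₘ≺pₖ = m , ≺-≼-trans pₘ≺pₖ pₖ≼a

module _ {S T : PreNatural} (f : RefinementMorphism S T) where
  private
    module S = PreNatural S
    module T = PreNatural T
  open RefinementMorphism f

  induced-reflects-# : ∀ p q → induced p T.#ₚ induced q → p S.#ₚ q
  induced-reflects-# _ _ (n , fpₙ#fqₙ) = n , refl-# fpₙ#fqₙ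

  induced-hat : ∀ a p → S.hat a p → T.hat (fun a) (induced p)
  induced-hat _ p (k , pₖ≼a , _) = ≼⇒hat T (induced p) k (mono pₖ≼a)

  induced-continuous : ContinuousOpen {S} {T} induced
  induced-continuous U U-open x fx∈U y with U-open (induced x) fx∈U (induced y)
  ... | inj₁ fy#fx       = inj₁ (induced-reflects-# y x fy#fx)
  ... | inj₂ (m , fŷₘ⊆U) = inj₂ (m , λ {p} p∈ŷₘ → fŷₘ⊆U (induced-hat (proj₁ y m) p p∈ŷₘ))

mainTheorem2 : (S T : PreNatural) → IsNatural S → IsNatural T →
    (f : RefinementMorphism S T) →
    ContinuousOpen {S} {T} (RefinementMorphism.induced f)
mainTheorem2 _ _ _ _ = induced-continuous
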